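{- Let $b\ge2$ be an integer, $\mathbf{a},\mathbf{b}$ distinct integers in $\{0,\dots,b-1\}$, and $\theta=[0;a_1,a_2,\dots]\in(0,1)$ irrational with convergent denominators $q_k$. Let $k\ge3$ be an integer and $V$ a finite word over $\{\mathbf{a},\mathbf{b}\}$. Let $\mathbf{x}$ be an infinite word over $\{\mathbf{a},\mathbf{b}\}$ having $VM_kM_k$ as a prefix, and put $\mathbf{y}=VM'_k(M_k)^\infty$. Then there exists a real number $\eta_k$ with $|\eta_k|\le1$ such that $$\xi_{\mathbf{x}}-\xi_{\mathbf{y}}=\frac{(-1)^k(\mathbf{b}-\mathbf{a})(b-1)}{b^{|V|+q_k}}+\frac{(-1)^k(\mathbf{b}-\mathbf{a})(b-1)+\eta_k}{b^{|V|+2q_k}}.$$ In particular, if $V=(M_k)^sM_{k-1}$ for some nonnegative integer $s$, then $\mathbf{y}=(M_k)^sM_{k-1}M'_k(M_k)^\infty=(M_k)^\infty$ and $$\xi_{\mathbf{x}}-\xi_{\mathbf{y}}=\frac{(-1)^k(\mathbf{b}-\mathbf{a})(b-1)}{b^{(s+1)q_k+q_{k-1}}}+\frac{(-1)^k(\mathbf{b}-\mathbf{a})(b-1)+\eta_k}{b^{(s+2)q_k+q_{k-1}}}.$$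
   Context: Convergents $p_k/q_k=[0;a_1,\dots,a_k]$, so $q_0=1$, $q_1=a_1$, $q_k=a_kq_{k-1}+q_{k-2}$. Words: $M_0=\mathbf{a}$, $M_1=\mathbf{a}^{a_1-1}\mathbf{b}$, $M_k=(M_{k-1})^{a_k}M_{k-2}$ for $k\ge2$ (so $|M_k|=q_k$), and $M'_k=(M_{k-1})^{a_k-1}M_{k-2}$. $|W|$ is the length of a word $W$, $W^\infty$ the infinite periodic word $WWW\cdots$. For an infinite word $\mathbf{z}=z_1z_2\cdots$ over $\{0,\dots,b-1\}$, $\xi_{\mathbf{z}}=\sum_{n\ge1}z_nb^{ -n}$. -}

module Defs where

open import Data.Nat using (ℕ; zero; suc; _+_; _*_; _∸_; _^_; _<_; _≤_; _<ᵇ_; _%_)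
open import Data.List using (List; []; _∷_; _++_; replicate; length)
open import Data.Bool using (if_then_else_)
open import Data.Integer as ℤ using (ℤ; +_; -_; ∣_∣)
open import Data.Product using (∃; _×_)
open import Relation.Binary.PropositionalEquality using (_≡_)

data Ltr : Set where
  A B : Ltr

digit : ℕ → ℕ → Ltr → ℕ
digit dA dB A = dA
digit dA dB B = dB

pow : List Ltr → ℕ → List Ltr
pow W zero    = []
pow W (suc n) = W ++ pow W n

-- Partial quotients a : ℕ → ℕ, a n = a_n (a 0 is unused).
-- M_0 = 𝐚, M_1 = 𝐚^(a_1 - 1) 𝐛, M_k = (M_{k-1})^{a_k} M_{k-2}.
M : (ℕ → ℕ) → ℕ → List Ltr
M a zero          = A ∷ []
M a (suc zero)    = replicate (a 1 ∸ 1) A ++ (B ∷ [])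
M a (suc (suc k)) = pow (M a (suc k)) (a (suc (suc k))) ++ M a k

-- M'_k = (M_{k-1})^{a_k - 1} M_{k-2}  (only meaningful for k ≥ 2;
-- the values for k = 0, 1 are junk and never used).
M' : (ℕ → ℕ) → ℕ → List Ltr
M' a zero          = []
M' a (suc zero)    = []
M' a (suc (suc k)) = pow (M a (suc k)) (a (suc (suc k)) ∸ 1) ++ M a k

q : (ℕ → ℕ) → ℕ → ℕ
q a zero          = 1
q a (suc zero)    = a 1
q a (suc (suc k)) = a (suc (suc k)) * q a (suc k) + q a k

-- Infinite words over {𝐚,𝐛} are functions ℕ → Ltr; position n (from 0)
-- holds the letter z_{n+1}.

-- n-th letter (0-based) of a finite word (junk value A out of range).
at : List Ltr → ℕ → Ltr
at []       _       = A
at (w ∷ ws) zero    = w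
at (w ∷ ws) (suc n) = at ws n

_mod⁺_ : ℕ → ℕ → ℕ
n mod⁺ zero  = zero
n mod⁺ suc m = n % suc m

-- W^∞  (W is always nonempty where used)
cyc : List Ltr → ℕ → Ltr
cyc W n = at W (n mod⁺ length W)

prePer : List Ltr → List Ltr → ℕ → Ltr
prePer P W n = if n <ᵇ length P then at P n else cyc W (n ∸ length P)

IsPrefix : List Ltr → (ℕ → Ltr) → Set
IsPrefix W x = ∀ n → n < length W → x n ≡ at W n

-- num b d z N = b^N · Σ_{n=1}^{N} d(z_n) b^{-n}  (an integer):
-- the N-th partial sum of ξ_z, scaled by b^N.
num : ℕ → (Ltr → ℕ) → (ℕ → Ltr) → ℕ → ℕ
num b d z zero    = zero
num b d z (suc N) = b * num b d z N + d (z N)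

sgn : ℕ → ℤ
sgn zero    = + 1
sgn (suc k) = - sgn k

-- XiExpansion b d x y e₁ e₂ C  (with e₁ ≤ e₂) encodes
--   ∃ η ∈ ℝ, |η| ≤ 1,  ξ_x - ξ_y = C / b^{e₁} + (C + η) / b^{e₂},
-- i.e.  | b^{e₂} (ξ_x - ξ_y) - C (b^{e₂-e₁} + 1) | ≤ 1.
-- Since ξ_x - ξ_y is the limit of Δ_N / b^N, Δ_N = num x N - num y N, with
-- |ξ_x - ξ_y - Δ_N / b^N| ≤ b^{-N}, this closed condition on the limit is
-- equivalent to: for every N,
--   | Δ_N b^{e₂} - C (b^{e₂-e₁} + 1) b^N | ≤ b^N + b^{e₂}.
XiExpansion : ℕ → (Ltr → ℕ) → (ℕ → Ltr) → (ℕ → Ltr) → ℕ → ℕ → ℤ → Set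
XiExpansion b d x y e₁ e₂ C =
  ∀ N → ∣ (+ num b d x N ℤ.- + num b d y N) ℤ.* + (b ^ e₂)
          ℤ.- C ℤ.* + (b ^ (e₂ ∸ e₁) + 1) ℤ.* + (b ^ N) ∣
        ≤ b ^ N + b ^ e₂

{-# OPTIONS --safe #-}
module Submission where

-- Write M_k = M_{k-1} M'_k.  Then x begins with V M_k M_k, while y = V M'_k (M_{k-1} M'_k)^∞
-- begins with V R R for the rotation R = M'_k M_{k-1} of M_k.  Read as base-b numerals these
-- prefixes differ by (val M_k - val R)(b^{q_k} + 1), and val M_k - val R equals
-- val (M_{k-1} M_{k-2}) - val (M_{k-2} M_{k-1}) because M_{k-1} commutes with its powers.
-- This swap difference changes sign from each index to the next, and for M_1 M_0 against
-- M_0 M_1 (common prefix 𝐚^{a_1-1}, then 𝐛𝐚 against 𝐚𝐛) it is (𝐛 - 𝐚)(b - 1).  The digits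
-- beyond position |V| + 2 q_k move ξ_x - ξ_y by at most b^{-|V|-2q_k}: this is η_k.

open import Defs
open import Data.Nat using (ℕ; zero; suc; _+_; _*_; _∸_; _^_; _%_; _⊔_; _<_; _≤_; _≥_; z≤n; s≤s; NonZero; >-nonZero)
open import Data.Nat.Properties
open import Data.Nat.DivMod using (m<n⇒m%n≡m; [m+n]%n≡m%n)
open import Data.List using (List; []; _∷_; _++_; length; replicate)
open import Data.List.Properties
  using (length-++; length-++-≤ˡ; length-++-≤ʳ; length-++-comm; length-replicate; ++-assoc; ++-identityʳ; ++-monoid)
open import Data.Integer as ℤ using (ℤ; +_; ∣_∣)
import Data.Integer.Properties as ℤ
open import Data.Product using (_×_; _,_)
open import Data.Sum using (inj₁; inj₂)
open import Relation.Nullary using (yes; no)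
open import Relation.Binary.PropositionalEquality
open import Tactic.MonoidSolver using (solve)
import Data.Nat.Tactic.RingSolver as ℕ-Ring
import Data.Integer.Tactic.RingSolver as ℤ-Ring

pos-*-+ : ∀ m n k → + (m * n + k) ≡ + m ℤ.* + n ℤ.+ + k
pos-*-+ m n k = trans (ℤ.pos-+ (m * n) k) (cong (ℤ._+ + k) (ℤ.pos-* m n))

∣m-n∣≤o : ∀ {m n o} → m < o → n < o → ∣ + m ℤ.- + n ∣ ≤ o
∣m-n∣≤o {m} {n} {o} m<o n<o = begin
  ∣ + m ℤ.- + n ∣ ≡⟨ cong ∣_∣ (ℤ.m-n≡m⊖n m n) ⟩
  ∣ m ℤ.⊖ n ∣     ≤⟨ ℤ.∣m⊝n∣≤m⊔n m n ⟩
  m ⊔ n           ≤⟨ ⊔-lub (<⇒≤ m<o) (<⇒≤ n<o) ⟩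
  o               ∎
  where open ≤-Reasoning

at-++ˡ : ∀ U W {n} → n < length U → at (U ++ W) n ≡ at U n
at-++ˡ (u ∷ U) W {zero}  _        = refl
at-++ˡ (u ∷ U) W {suc n} (s≤s n<) = at-++ˡ U W n<

at-++ʳ : ∀ U W n → at (U ++ W) (length U + n) ≡ at W n
at-++ʳ []      W n = refl
at-++ʳ (u ∷ U) W n = at-++ʳ U W n

IsPrefix-resp-≗ : ∀ W {z z'} → (∀ n → z n ≡ z' n) → IsPrefix W z → IsPrefix W z'
IsPrefix-resp-≗ W z≗z' W≺z n n< = trans (sym (z≗z' n)) (W≺z n n<)

IsPrefix-++ˡ : ∀ U R {z} → IsPrefix (U ++ R) z → IsPrefix U z
IsPrefix-++ˡ U R h n n< = trans (h n (≤-trans n< (length-++-≤ˡ U))) (at-++ˡ U R n<)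

length-pow : ∀ W t → length (pow W t) ≡ t * length W
length-pow W zero    = refl
length-pow W (suc t) = trans (length-++ W) (cong (λ m → length W + m) (length-pow W t))

pow-comm : ∀ W t → W ++ pow W t ≡ pow W t ++ W
pow-comm W zero    = ++-identityʳ W
pow-comm W (suc t) = trans (cong (W ++_) (pow-comm W t)) (sym (++-assoc W (pow W t) W))

prePer-< : ∀ P W {n} → n < length P → prePer P W n ≡ at P n
prePer-< (p ∷ P) W {zero}  _        = refl
prePer-< (p ∷ P) W {suc n} (s≤s n<) = prePer-< P W n<

prePer-+ : ∀ P W n → prePer P W (length P + n) ≡ cyc W n
prePer-+ []      W n = refl
prePer-+ (p ∷ P) W n = prePer-+ P W n

mod⁺≡% : ∀ n m .{{_ : NonZero m}} → n mod⁺ m ≡ n % m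
mod⁺≡% n (suc m) = refl

module _ (W : List Ltr) .{{_ : NonZero (length W)}} where

  cyc-< : ∀ {n} → n < length W → cyc W n ≡ at W n
  cyc-< {n} n< = cong (at W) (trans (mod⁺≡% n (length W)) (m<n⇒m%n≡m n<))

  cyc-+ : ∀ n → cyc W (length W + n) ≡ cyc W n
  cyc-+ n = cong (at W) (begin
    (length W + n) mod⁺ length W ≡⟨ mod⁺≡% (length W + n) (length W) ⟩
    (length W + n) % length W    ≡⟨ cong (_% length W) (+-comm (length W) n) ⟩
    (n + length W) % length W    ≡⟨ [m+n]%n≡m%n n (length W) ⟩
    n % length W                 ≡⟨ mod⁺≡% n (length W) ⟨
    n mod⁺ length W              ∎)
    where open ≡-Reasoning

  cyc-unroll : ∀ n → cyc W n ≡ prePer W W n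
  cyc-unroll n with n <? length W
  ... | yes n< = trans (cyc-< n<) (sym (prePer-< W W n<))
  ... | no n≮ with m≤n⇒∃[o]m+o≡n (≮⇒≥ n≮)
  ...   | j , refl = trans (cyc-+ j) (sym (prePer-+ W W j))

  prePer-unroll : ∀ P n → prePer P W n ≡ prePer (P ++ W) W n
  prePer-unroll []      n       = cyc-unroll n
  prePer-unroll (p ∷ P) zero    = refl
  prePer-unroll (p ∷ P) (suc n) = prePer-unroll P n

  prePer-unroll-pow : ∀ P t n → prePer P W n ≡ prePer (P ++ pow W t) W n
  prePer-unroll-pow P zero    n = cong (λ Q → prePer Q W n) (sym (++-identityʳ P))
  prePer-unroll-pow P (suc t) n = begin
    prePer P W n                    ≡⟨ prePer-unroll P n ⟩
    prePer (P ++ W) W n             ≡⟨ prePer-unroll-pow (P ++ W) t n ⟩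
    prePer ((P ++ W) ++ pow W t) W n ≡⟨ cong (λ Q → prePer Q W n) (++-assoc P W (pow W t)) ⟩
    prePer (P ++ pow W (suc t)) W n ∎
    where open ≡-Reasoning

  prePer-prefix : ∀ P t → IsPrefix (P ++ pow W t) (prePer P W)
  prePer-prefix P t n n< = trans (prePer-unroll-pow P t n) (prePer-< (P ++ pow W t) W n<)

  prePer-pow : ∀ s n → prePer (pow W s) W n ≡ cyc W n
  prePer-pow s n = sym (prePer-unroll-pow [] s n)

prePer-rotate-prefix : ∀ V U W {X} .{{_ : NonZero (length X)}} → X ≡ W ++ U →
                       IsPrefix (V ++ (U ++ W) ++ (U ++ W)) (prePer (V ++ U) X)
prePer-rotate-prefix V U W refl =
  IsPrefix-++ˡ (V ++ (U ++ W) ++ (U ++ W)) U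
    (subst (λ P → IsPrefix P (prePer (V ++ U) (W ++ U))) regroup (prePer-prefix (W ++ U) (V ++ U) 2))
  where
  regroup : (V ++ U) ++ (W ++ U) ++ (W ++ U) ++ [] ≡ (V ++ (U ++ W) ++ (U ++ W)) ++ U
  regroup = solve (++-monoid Ltr)

module Numeral (b : ℕ) (d : Ltr → ℕ) where

  num-cong : ∀ {z z'} N → (∀ n → n < N → z n ≡ z' n) → num b d z N ≡ num b d z' N
  num-cong zero    _ = refl
  num-cong (suc N) h = cong₂ (λ u w → b * u + d w) (num-cong N (λ n n< → h n (m<n⇒m<1+n n<))) (h N (n<1+n N))

  num-+ : ∀ z m n → num b d z (m + n) ≡ num b d z m * b ^ n + num b d (λ i → z (m + i)) n
  num-+ z m zero    = trans (cong (num b d z) (+-identityʳ m)) (sym (trans (+-identityʳ _) (*-identityʳ _)))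
  num-+ z m (suc n) = begin
    num b d z (m + suc n)                                   ≡⟨ cong (num b d z) (+-suc m n) ⟩
    b * num b d z (m + n) + d (z (m + n))                   ≡⟨ cong (λ u → b * u + d (z (m + n))) (num-+ z m n) ⟩
    b * (num b d z m * b ^ n + r) + d (z (m + n))           ≡⟨ distrib b (num b d z m) (b ^ n) r (d (z (m + n))) ⟩
    num b d z m * (b * b ^ n) + (b * r + d (z (m + n)))     ∎
    where
    open ≡-Reasoning
    r = num b d (λ i → z (m + i)) n
    distrib : ∀ b N P r e → b * (N * P + r) + e ≡ N * (b * P) + (b * r + e)
    distrib = ℕ-Ring.solve-∀

  val : List Ltr → ℕ
  val W = num b d (at W) (length W)

  num-prefix : ∀ W {z} → IsPrefix W z → num b d z (length W) ≡ val W
  num-prefix W W≺z = num-cong (length W) W≺z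

  val-++ : ∀ U W → + val (U ++ W) ≡ + val U ℤ.* + (b ^ length W) ℤ.+ + val W
  val-++ U W = begin
    + num b d (at (U ++ W)) (length (U ++ W))
      ≡⟨ cong (λ n → + num b d (at (U ++ W)) n) (length-++ U) ⟩
    + num b d (at (U ++ W)) (length U + length W)
      ≡⟨ cong +_ (num-+ (at (U ++ W)) (length U) (length W)) ⟩
    + (num b d (at (U ++ W)) (length U) * b ^ length W + num b d (λ i → at (U ++ W) (length U + i)) (length W))
      ≡⟨ cong₂ (λ u w → + (u * b ^ length W + w))
               (num-cong (length U) (λ _ → at-++ˡ U W)) (num-cong (length W) (λ n _ → at-++ʳ U W n)) ⟩
    + (val U * b ^ length W + val W)
      ≡⟨ pos-*-+ (val U) (b ^ length W) (val W) ⟩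
    + val U ℤ.* + (b ^ length W) ℤ.+ + val W ∎
    where open ≡-Reasoning

  val-cancelˡ : ∀ P S T → length S ≡ length T → + val (P ++ S) ℤ.- + val (P ++ T) ≡ + val S ℤ.- + val T
  val-cancelˡ P S T |S|≡|T| = begin
    + val (P ++ S) ℤ.- + val (P ++ T)
      ≡⟨ cong₂ ℤ._-_ (val-++ P S) (trans (val-++ P T) (cong (λ n → + val P ℤ.* + (b ^ n) ℤ.+ + val T) (sym |S|≡|T|))) ⟩
    (+ val P ℤ.* + (b ^ length S) ℤ.+ + val S) ℤ.- (+ val P ℤ.* + (b ^ length S) ℤ.+ + val T)
      ≡⟨ cancel (+ val P ℤ.* + (b ^ length S)) (+ val S) (+ val T) ⟩
    + val S ℤ.- + val T ∎
    where
    open ≡-Reasoning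
    cancel : ∀ p s t → (p ℤ.+ s) ℤ.- (p ℤ.+ t) ≡ s ℤ.- t
    cancel = ℤ-Ring.solve-∀

  val-pow-shift : ∀ W Z t → + val (W ++ pow W t ++ Z) ℤ.- + val ((pow W t ++ Z) ++ W)
                            ≡ + val (W ++ Z) ℤ.- + val (Z ++ W)
  val-pow-shift W Z t = begin
    + val (W ++ P ++ Z) ℤ.- + val ((P ++ Z) ++ W) ≡⟨ cong₂ (λ u w → + val u ℤ.- + val w) commute (++-assoc P Z W) ⟩
    + val (P ++ W ++ Z) ℤ.- + val (P ++ Z ++ W)   ≡⟨ val-cancelˡ P (W ++ Z) (Z ++ W) (length-++-comm W Z) ⟩
    + val (W ++ Z) ℤ.- + val (Z ++ W)             ∎
    where
    open ≡-Reasoning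
    P = pow W t
    commute : W ++ P ++ Z ≡ P ++ W ++ Z
    commute = trans (sym (++-assoc W P Z)) (trans (cong (_++ Z) (pow-comm W t)) (++-assoc P W Z))

  val-++-square : ∀ V X Y → length X ≡ length Y →
                  + val (V ++ X ++ X) ℤ.- + val (V ++ Y ++ Y) ≡ (+ val X ℤ.- + val Y) ℤ.* + (b ^ length X + 1)
  val-++-square V X Y |X|≡|Y| = begin
    + val (V ++ X ++ X) ℤ.- + val (V ++ Y ++ Y)
      ≡⟨ val-cancelˡ V (X ++ X) (Y ++ Y) (trans (length-++ X) (trans (cong₂ _+_ |X|≡|Y| |X|≡|Y|) (sym (length-++ Y)))) ⟩
    + val (X ++ X) ℤ.- + val (Y ++ Y)
      ≡⟨ cong₂ ℤ._-_ (val-++ X X) (trans (val-++ Y Y) (cong (λ n → + val Y ℤ.* + (b ^ n) ℤ.+ + val Y) (sym |X|≡|Y|))) ⟩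
    (+ val X ℤ.* + (b ^ length X) ℤ.+ + val X) ℤ.- (+ val Y ℤ.* + (b ^ length X) ℤ.+ + val Y)
      ≡⟨ factor (+ val X) (+ val Y) (+ (b ^ length X)) ⟩
    (+ val X ℤ.- + val Y) ℤ.* (+ (b ^ length X) ℤ.+ + 1)
      ≡⟨ cong (λ u → (+ val X ℤ.- + val Y) ℤ.* u) (ℤ.pos-+ (b ^ length X) 1) ⟨
    (+ val X ℤ.- + val Y) ℤ.* + (b ^ length X + 1) ∎
    where
    open ≡-Reasoning
    factor : ∀ x y B → (x ℤ.* B ℤ.+ x) ℤ.- (y ℤ.* B ℤ.+ y) ≡ (x ℤ.- y) ℤ.* (B ℤ.+ + 1)
    factor = ℤ-Ring.solve-∀

  Δ : (ℕ → Ltr) → (ℕ → Ltr) → ℕ → ℤ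
  Δ x y N = + num b d x N ℤ.- + num b d y N

  module _ (d<b : ∀ w → d w < b) where

    num<b^ : ∀ z n → num b d z n < b ^ n
    num<b^ z zero    = s≤s z≤n
    num<b^ z (suc n) = begin-strict
      b * num b d z n + d (z n) <⟨ +-monoʳ-< (b * num b d z n) (d<b (z n)) ⟩
      b * num b d z n + b       ≡⟨ +-comm (b * num b d z n) b ⟩
      b + b * num b d z n       ≡⟨ *-suc b (num b d z n) ⟨
      b * suc (num b d z n)     ≤⟨ *-monoʳ-≤ b (num<b^ z n) ⟩
      b * b ^ n                 ∎
      where open ≤-Reasoning

    Δ-tail : ∀ x y m j → ∣ Δ x y m ℤ.* + (b ^ (m + j)) ℤ.- Δ x y (m + j) ℤ.* + (b ^ m) ∣ ≤ b ^ (m + j)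
    Δ-tail x y m j = begin
      ∣ Δ x y m ℤ.* + (b ^ (m + j)) ℤ.- Δ x y (m + j) ℤ.* + (b ^ m) ∣ ≡⟨ cong ∣_∣ tails ⟩
      ∣ (+ ry ℤ.- + rx) ℤ.* + (b ^ m) ∣                              ≡⟨ ℤ.abs-* (+ ry ℤ.- + rx) (+ (b ^ m)) ⟩
      ∣ + ry ℤ.- + rx ∣ * b ^ m                                       ≤⟨ *-monoˡ-≤ (b ^ m) (∣m-n∣≤o (num<b^ _ j) (num<b^ _ j)) ⟩
      b ^ j * b ^ m                                                   ≡⟨ *-comm (b ^ j) (b ^ m) ⟩
      b ^ m * b ^ j                                                   ≡⟨ ^-distribˡ-+-* b m j ⟨
      b ^ (m + j)                                                     ∎
      where
      open ≤-Reasoning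
      rx = num b d (λ i → x (m + i)) j
      ry = num b d (λ i → y (m + i)) j
      num-+ℤ : ∀ z → + num b d z (m + j) ≡ + num b d z m ℤ.* + (b ^ j) ℤ.+ + num b d (λ i → z (m + i)) j
      num-+ℤ z = trans (cong +_ (num-+ z m j)) (pos-*-+ (num b d z m) (b ^ j) (num b d (λ i → z (m + i)) j))
      cancel : ∀ nx ny rx ry P B → (nx ℤ.- ny) ℤ.* (P ℤ.* B) ℤ.- ((nx ℤ.* B ℤ.+ rx) ℤ.- (ny ℤ.* B ℤ.+ ry)) ℤ.* P
                                   ≡ (ry ℤ.- rx) ℤ.* P
      cancel = ℤ-Ring.solve-∀
      tails : Δ x y m ℤ.* + (b ^ (m + j)) ℤ.- Δ x y (m + j) ℤ.* + (b ^ m) ≡ (+ ry ℤ.- + rx) ℤ.* + (b ^ m)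
      tails = trans (cong₂ (λ P D → Δ x y m ℤ.* P ℤ.- D ℤ.* + (b ^ m))
                      (trans (cong +_ (^-distribˡ-+-* b m j)) (ℤ.pos-* (b ^ m) (b ^ j)))
                      (cong₂ ℤ._-_ (num-+ℤ x) (num-+ℤ y)))
                    (cancel (+ num b d x m) (+ num b d y m) (+ rx) (+ ry) (+ (b ^ m)) (+ (b ^ j)))

    -- Divided by b^(N + E), this reads  |Δ_N / b^N - Δ_E / b^E| ≤ b^(-E) + b^(-N).
    Δ-cross : ∀ x y N E → ∣ Δ x y N ℤ.* + (b ^ E) ℤ.- Δ x y E ℤ.* + (b ^ N) ∣ ≤ b ^ N + b ^ E
    Δ-cross x y N E with ≤-total N E
    ... | inj₁ N≤E with m≤n⇒∃[o]m+o≡n N≤E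
    ...   | j , refl = ≤-trans (Δ-tail x y N j) (m≤n+m (b ^ (N + j)) (b ^ N))
    Δ-cross x y N E | inj₂ E≤N with m≤n⇒∃[o]m+o≡n E≤N
    ...   | j , refl = begin
      ∣ Δ x y (E + j) ℤ.* + (b ^ E) ℤ.- Δ x y E ℤ.* + (b ^ (E + j)) ∣
        ≡⟨ ℤ.∣i-j∣≡∣j-i∣ (Δ x y (E + j) ℤ.* + (b ^ E)) (Δ x y E ℤ.* + (b ^ (E + j))) ⟩
      ∣ Δ x y E ℤ.* + (b ^ (E + j)) ℤ.- Δ x y (E + j) ℤ.* + (b ^ E) ∣ ≤⟨ Δ-tail x y E j ⟩
      b ^ (E + j)                                                     ≤⟨ m≤m+n (b ^ (E + j)) (b ^ E) ⟩
      b ^ (E + j) + b ^ E                                             ∎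
      where open ≤-Reasoning

    XiExpansion-of-Δ : ∀ x y e₁ e₂ C → Δ x y e₂ ≡ C ℤ.* + (b ^ (e₂ ∸ e₁) + 1) → XiExpansion b d x y e₁ e₂ C
    XiExpansion-of-Δ x y e₁ e₂ C Δ≡ N =
      subst (λ D → ∣ Δ x y N ℤ.* + (b ^ e₂) ℤ.- D ℤ.* + (b ^ N) ∣ ≤ b ^ N + b ^ e₂) Δ≡ (Δ-cross x y N e₂)

    XiExpansion-of-prefixes : ∀ V X Y {x y} → length X ≡ length Y →
                              IsPrefix (V ++ X ++ X) x → IsPrefix (V ++ Y ++ Y) y →
                              XiExpansion b d x y (length V + length X) (length V + 2 * length X) (+ val X ℤ.- + val Y)
    XiExpansion-of-prefixes V X Y {x} {y} |X|≡|Y| x≺ y≺ =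
      XiExpansion-of-Δ x y (length V + length X) (length V + 2 * length X) (+ val X ℤ.- + val Y) (begin
      Δ x y (length V + 2 * length X)
        ≡⟨ cong₂ (λ u w → + u ℤ.- + w) (prefix-value (V ++ X ++ X) x≺ |V++X++X|) (prefix-value (V ++ Y ++ Y) y≺ |V++Y++Y|) ⟩
      + val (V ++ X ++ X) ℤ.- + val (V ++ Y ++ Y)      ≡⟨ val-++-square V X Y |X|≡|Y| ⟩
      (+ val X ℤ.- + val Y) ℤ.* + (b ^ length X + 1)   ≡⟨ cong (λ e → (+ val X ℤ.- + val Y) ℤ.* + (b ^ e + 1)) gap ⟨
      (+ val X ℤ.- + val Y) ℤ.* + (b ^ ((length V + 2 * length X) ∸ (length V + length X)) + 1) ∎)
      where
      open ≡-Reasoning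
      prefix-value : ∀ W {z E} → IsPrefix W z → length W ≡ E → num b d z E ≡ val W
      prefix-value W W≺z refl = num-prefix W W≺z
      length-V++W++W : ∀ W → length (V ++ W ++ W) ≡ length V + 2 * length W
      length-V++W++W W = trans (length-++ V) (cong (λ n → length V + n)
                           (trans (length-++ W) (cong (λ n → length W + n) (sym (+-identityʳ (length W))))))
      |V++X++X| : length (V ++ X ++ X) ≡ length V + 2 * length X
      |V++X++X| = length-V++W++W X
      |V++Y++Y| : length (V ++ Y ++ Y) ≡ length V + 2 * length X
      |V++Y++Y| = trans (length-V++W++W Y) (cong (λ n → length V + 2 * n) (sym |X|≡|Y|))
      gap : (length V + 2 * length X) ∸ (length V + length X) ≡ length X
      gap = trans ([m+n]∸[m+o]≡n∸o (length V) (2 * length X) (length X))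
                  (trans (m+n∸m≡n (length X) (length X + 0)) (+-identityʳ (length X)))

∷-replicate : ∀ {A : Set} n (x : A) ys → x ∷ replicate n x ++ ys ≡ replicate n x ++ x ∷ ys
∷-replicate zero    x ys = refl
∷-replicate (suc n) x ys = cong (x ∷_) (∷-replicate n x ys)

module Sturmian (a : ℕ → ℕ) where

  length-M : a 1 ≥ 1 → ∀ k → length (M a k) ≡ q a k
  length-M a₁≥1 zero          = refl
  length-M a₁≥1 (suc zero)    = begin
    length (replicate (a 1 ∸ 1) A ++ B ∷ []) ≡⟨ length-++ (replicate (a 1 ∸ 1) A) ⟩
    length (replicate (a 1 ∸ 1) A) + 1       ≡⟨ cong (_+ 1) (length-replicate (a 1 ∸ 1)) ⟩
    a 1 ∸ 1 + 1                              ≡⟨ m∸n+n≡m a₁≥1 ⟩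
    a 1                                      ∎
    where open ≡-Reasoning
  length-M a₁≥1 (suc (suc k)) = begin
    length (pow (M a (suc k)) (a (2 + k)) ++ M a k)           ≡⟨ length-++ (pow (M a (suc k)) (a (2 + k))) ⟩
    length (pow (M a (suc k)) (a (2 + k))) + length (M a k)  ≡⟨ cong (λ n → n + length (M a k)) (length-pow (M a (suc k)) (a (2 + k))) ⟩
    a (2 + k) * length (M a (suc k)) + length (M a k)        ≡⟨ cong₂ (λ m n → a (2 + k) * m + n) (length-M a₁≥1 (suc k)) (length-M a₁≥1 k) ⟩
    a (2 + k) * q a (suc k) + q a k                          ∎
    where open ≡-Reasoning

  0<length-M : ∀ k → 0 < length (M a k)
  0<length-M zero          = s≤s z≤n
  0<length-M (suc zero)    = length-++-≤ʳ (B ∷ []) {replicate (a 1 ∸ 1) A}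
  0<length-M (suc (suc k)) = ≤-trans (0<length-M k) (length-++-≤ʳ (M a k) {pow (M a (suc k)) (a (2 + k))})

  M-split : ∀ i → a (2 + i) ≥ 1 → M a (2 + i) ≡ M a (1 + i) ++ M' a (2 + i)
  M-split i a≥1 with a (2 + i) | a≥1
  ... | suc t | _ = ++-assoc (M a (1 + i)) (pow (M a (1 + i)) t) (M a i)

  module _ (b dA dB : ℕ) where
    open Numeral b (digit dA dB)

    val-swap : ∀ i → + val (M a (1 + i) ++ M a i) ℤ.- + val (M a i ++ M a (1 + i))
                     ≡ sgn (2 + i) ℤ.* (+ dB ℤ.- + dA) ℤ.* (+ b ℤ.- + 1)
    val-swap zero = begin
      + val ((R ++ B ∷ []) ++ A ∷ []) ℤ.- + val (A ∷ R ++ B ∷ [])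
        ≡⟨ cong₂ (λ u w → + val u ℤ.- + val w) (++-assoc R (B ∷ []) (A ∷ [])) (∷-replicate (a 1 ∸ 1) A (B ∷ [])) ⟩
      + val (R ++ B ∷ A ∷ []) ℤ.- + val (R ++ A ∷ B ∷ [])
        ≡⟨ val-cancelˡ R (B ∷ A ∷ []) (A ∷ B ∷ []) refl ⟩
      + val (B ∷ A ∷ []) ℤ.- + val (A ∷ B ∷ [])
        ≡⟨ cong₂ ℤ._-_ (val-pair dB dA) (val-pair dA dB) ⟩
      (+ dB ℤ.* + b ℤ.+ + dA) ℤ.- (+ dA ℤ.* + b ℤ.+ + dB)
        ≡⟨ factor (+ dB) (+ dA) (+ b) ⟩
      + 1 ℤ.* (+ dB ℤ.- + dA) ℤ.* (+ b ℤ.- + 1) ∎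
      where
      open ≡-Reasoning
      R = replicate (a 1 ∸ 1) A
      val-pair : ∀ u w → + (b * (b * 0 + u) + w) ≡ + u ℤ.* + b ℤ.+ + w
      val-pair u w = trans (cong +_ (cong (_+ w) (trans (cong (b *_) (cong (_+ u) (*-zeroʳ b))) (*-comm b u)))) (pos-*-+ u b w)
      factor : ∀ x y c → (x ℤ.* c ℤ.+ y) ℤ.- (y ℤ.* c ℤ.+ x) ≡ + 1 ℤ.* (x ℤ.- y) ℤ.* (c ℤ.- + 1)
      factor = ℤ-Ring.solve-∀
    val-swap (suc i) = begin
      + val ((P ++ Z) ++ W) ℤ.- + val (W ++ P ++ Z)            ≡⟨ flip (+ val ((P ++ Z) ++ W)) (+ val (W ++ P ++ Z)) ⟩
      ℤ.- (+ val (W ++ P ++ Z) ℤ.- + val ((P ++ Z) ++ W))       ≡⟨ cong ℤ.-_ (val-pow-shift W Z (a (2 + i))) ⟩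
      ℤ.- (+ val (W ++ Z) ℤ.- + val (Z ++ W))                   ≡⟨ cong ℤ.-_ (val-swap i) ⟩
      ℤ.- (sgn (2 + i) ℤ.* δ ℤ.* c)                             ≡⟨ neg-first (sgn (2 + i)) δ c ⟩
      sgn (3 + i) ℤ.* δ ℤ.* c                                   ∎
      where
      open ≡-Reasoning
      W = M a (1 + i)
      Z = M a i
      P = pow W (a (2 + i))
      δ = + dB ℤ.- + dA
      c = + b ℤ.- + 1
      neg-first : ∀ s x y → ℤ.- (s ℤ.* x ℤ.* y) ≡ (ℤ.- s) ℤ.* x ℤ.* y
      neg-first = ℤ-Ring.solve-∀
      flip : ∀ u w → u ℤ.- w ≡ ℤ.- (w ℤ.- u)
      flip = ℤ-Ring.solve-∀

    val-M-swap : ∀ i → a (2 + i) ≥ 1 →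
                 + val (M a (2 + i)) ℤ.- + val (M' a (2 + i) ++ M a (1 + i))
                 ≡ sgn (2 + i) ℤ.* (+ dB ℤ.- + dA) ℤ.* (+ b ℤ.- + 1)
    val-M-swap i a≥1 = begin
      + val (M a (2 + i)) ℤ.- + val ((P ++ Z) ++ W) ≡⟨ cong (λ u → + val u ℤ.- + val ((P ++ Z) ++ W)) (M-split i a≥1) ⟩
      + val (W ++ P ++ Z) ℤ.- + val ((P ++ Z) ++ W) ≡⟨ val-pow-shift W Z (a (2 + i) ∸ 1) ⟩
      + val (W ++ Z) ℤ.- + val (Z ++ W)             ≡⟨ val-swap i ⟩
      sgn (2 + i) ℤ.* (+ dB ℤ.- + dA) ℤ.* (+ b ℤ.- + 1) ∎
      where
      open ≡-Reasoning
      W = M a (1 + i)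
      Z = M a i
      P = pow W (a (2 + i) ∸ 1)

module Expansion (b dA dB : ℕ) (d<b : ∀ w → digit dA dB w < b)
                 (a : ℕ → ℕ) (a≥1 : ∀ n → 1 ≤ n → 1 ≤ a n) (i : ℕ) where
  open Numeral b (digit dA dB)
  open Sturmian a

  k = 2 + i
  W = M a (1 + i)
  Mk = M a k
  M'k = M' a k
  C = sgn k ℤ.* (+ dB ℤ.- + dA) ℤ.* (+ b ℤ.- + 1)

  instance
    Mk-nonempty : NonZero (length Mk)
    Mk-nonempty = >-nonZero (0<length-M k)

  a₁≥1 : a 1 ≥ 1
  a₁≥1 = a≥1 1 ≤-refl

  aₖ≥1 : a k ≥ 1
  aₖ≥1 = a≥1 k (s≤s z≤n)

  Mk-split : Mk ≡ W ++ M'k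
  Mk-split = M-split i aₖ≥1

  XiExpansion-of-rotation : ∀ V {x y} → IsPrefix (V ++ Mk ++ Mk) x → IsPrefix (V ++ (M'k ++ W) ++ (M'k ++ W)) y →
                            XiExpansion b (digit dA dB) x y (length V + q a k) (length V + 2 * q a k) C
  XiExpansion-of-rotation V {x} {y} x≺ y≺ =
    subst (λ Q → XiExpansion b (digit dA dB) x y (length V + Q) (length V + 2 * Q) C) (length-M a₁≥1 k)
      (subst (XiExpansion b (digit dA dB) x y (length V + length Mk) (length V + 2 * length Mk))
        (val-M-swap b dA dB i aₖ≥1)
        (XiExpansion-of-prefixes d<b V Mk (M'k ++ W) (trans (cong length Mk-split) (length-++-comm W M'k)) x≺ y≺))

  prefix-expansion : ∀ V x → IsPrefix (V ++ Mk ++ Mk) x →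
                     XiExpansion b (digit dA dB) x (prePer (V ++ M'k) Mk) (length V + q a k) (length V + 2 * q a k) C
  prefix-expansion V x x≺ = XiExpansion-of-rotation V x≺ (prePer-rotate-prefix V M'k W Mk-split)

  prePer-pow-Mk-W : ∀ s n → prePer (pow Mk s ++ W ++ M'k) Mk n ≡ cyc Mk n
  prePer-pow-Mk-W s n = trans (cong (λ P → prePer P Mk n) pow-Mk-W-M'k) (prePer-pow Mk (suc s) n)
    where
    pow-Mk-W-M'k : pow Mk s ++ W ++ M'k ≡ pow Mk (suc s)
    pow-Mk-W-M'k = trans (cong (pow Mk s ++_) (sym Mk-split)) (sym (pow-comm Mk s))

  cyc-Mk-prefix : ∀ s → IsPrefix ((pow Mk s ++ W) ++ (M'k ++ W) ++ (M'k ++ W)) (cyc Mk)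
  cyc-Mk-prefix s =
    IsPrefix-resp-≗ ((pow Mk s ++ W) ++ (M'k ++ W) ++ (M'k ++ W))
      (λ n → trans (cong (λ P → prePer P Mk n) (++-assoc (pow Mk s) W M'k)) (prePer-pow-Mk-W s n))
      (prePer-rotate-prefix (pow Mk s ++ W) M'k W Mk-split)

  length-pow-Mk-W : ∀ s → length (pow Mk s ++ W) ≡ s * q a k + q a (1 + i)
  length-pow-Mk-W s = trans (length-++ (pow Mk s))
    (cong₂ _+_ (trans (length-pow Mk s) (cong (s *_) (length-M a₁≥1 k))) (length-M a₁≥1 (1 + i)))

  periodic-expansion : ∀ s x → IsPrefix (pow Mk s ++ W ++ Mk ++ Mk) x →
                       (∀ n → prePer (pow Mk s ++ W ++ M'k) Mk n ≡ cyc Mk n) ×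
                       XiExpansion b (digit dA dB) x (cyc Mk)
                         ((s + 1) * q a k + q a (1 + i)) ((s + 2) * q a k + q a (1 + i)) C
  periodic-expansion s x x≺ = prePer-pow-Mk-W s ,
    subst₂ (λ e₁ e₂ → XiExpansion b (digit dA dB) x (cyc Mk) e₁ e₂ C)
      (trans (cong (_+ q a k) (length-pow-Mk-W s)) (regroup₁ s (q a k) (q a (1 + i))))
      (trans (cong (_+ 2 * q a k) (length-pow-Mk-W s)) (regroup₂ s (q a k) (q a (1 + i))))
      (XiExpansion-of-rotation (pow Mk s ++ W)
        (subst (λ P → IsPrefix P x) (sym (++-assoc (pow Mk s) W (Mk ++ Mk))) x≺) (cyc-Mk-prefix s))
    where
    regroup₁ : ∀ s Q Q' → s * Q + Q' + Q ≡ (s + 1) * Q + Q'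
    regroup₁ = ℕ-Ring.solve-∀
    regroup₂ : ∀ s Q Q' → s * Q + Q' + 2 * Q ≡ (s + 2) * Q + Q'
    regroup₂ = ℕ-Ring.solve-∀

lemma2p1 : (b : ℕ) → 2 ≤ b → (dA dB : ℕ) → dA < b → dB < b → dA ≢ dB →
           (a : ℕ → ℕ) → (∀ n → 1 ≤ n → 1 ≤ a n) →
           (k : ℕ) → 3 ≤ k →
           ((V : List Ltr) (x : ℕ → Ltr) →
              IsPrefix (V ++ M a k ++ M a k) x →
              XiExpansion b (digit dA dB) x (prePer (V ++ M' a k) (M a k))
                (length V + q a k) (length V + 2 * q a k)
                (sgn k ℤ.* (+ dB ℤ.- + dA) ℤ.* + (b ∸ 1)))
           ×
           ((s : ℕ) (x : ℕ → Ltr) →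
              IsPrefix (pow (M a k) s ++ M a (k ∸ 1) ++ M a k ++ M a k) x →
              ((n : ℕ) → prePer (pow (M a k) s ++ M a (k ∸ 1) ++ M' a k) (M a k) n
                           ≡ cyc (M a k) n)
              × XiExpansion b (digit dA dB) x (cyc (M a k))
                  ((s + 1) * q a k + q a (k ∸ 1)) ((s + 2) * q a k + q a (k ∸ 1))
                  (sgn k ℤ.* (+ dB ℤ.- + dA) ℤ.* + (b ∸ 1)))
-- Matching b as a successor makes
-- + (b ∸ 1) definitionally equal to the constant + b ℤ.- + 1 used in Expansion.
lemma2p1 b@(suc _) _ dA dB dA<b dB<b _ a a≥1 (suc (suc i)) (s≤s (s≤s _)) = prefix-expansion , periodic-expansion
  where
  d<b : ∀ w → digit dA dB w < b
  d<b A = dA<b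
  d<b B = dB<b
  open Expansion b dA dB d<b a a≥1 i
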